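{- Let $(\mathcal{H},\mathcal{V})$ be a 2-horizontal web with $h=|\mathcal{H}|$ and $v=|\mathcal{V}|$, and let $D$ be the digraph formed by the union of the paths of $\mathcal{H}$ and $\mathcal{V}$. Then $D$ has a haven of order $\min(h,v)$. In particular, $D$ has directed tree-width at least $\min(h,v)-1$.
   Context: A linkage is a set of pairwise vertex-disjoint directed paths; $|\mathcal{L}|$ is its order. A web $(\mathcal{H},\mathcal{V})$ is a pair of linkages with every path of $\mathcal{V}$ intersecting every path of $\mathcal{H}$. It is 2-horizontal if every $H_i\in\mathcal{H}$ decomposes into consecutive subpaths $H_i=H_i^1\cdot H_i^2$ and every $V_j\in\mathcal{V}$ into $V_j=V_j^1\cdot V_j^2$ (consecutive subpaths sharing their common endpoint) such that $V_j^1\cap H_i\subseteq H_i^1\cup H_i^2$, $V_j^1\cap H_i^2\ne\emptyset$, $V_j^2\cap H_i\subseteq H_i^1$ and $V_j^2\cap H_i^1\ne\emptyset$. A haven of order $w$ in a digraph $D$ is a function $\beta$ assigning to every set $Z\subseteq V(D)$ with $|Z|<w$ the vertex set of a strong component of $D-Z$, such that $Z'\subseteq Z$ implies $\beta(Z)\subseteq\beta(Z')$. Directed tree-width: a directed tree-decomposition of $D$ is $(T,\beta,\gamma)$ with $T$ an arborescence, the bags $\beta(t)$ partitioning $V(D)$ (possibly empty), guards $\gamma(e)\subseteq V(D)$ for arcs $e$ of $T$, such that for every arc $e=(s,t)$ of $T$, with $A$ the union of bags of vertices reachable from $t$ and $B=V(D)\setminus A$, no closed directed walk in $D-\gamma(e)$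 meets both $A$ and $B$; width is the least $w$ with $|\beta(t)\cup\bigcup_{e\ni t}\gamma(e)|\le w+1$ for all $t$; $\mathrm{dtw}(D)$ is the minimum width. -}

module Defs where

open import Data.Nat using (ℕ; zero; suc; _<_; _≤_; _+_)
open import Data.Fin using (Fin; _≟_)
open import Data.Fin.Subset using (Subset; _∈_; _∉_; _⊆_; ∣_∣; _∪_; ⋃) renaming (⊥ to ∅)
open import Data.List using (List; []; _∷_; _++_; [_]; length; take; drop; map; filter; allFin)
import Data.List.Membership.Propositional as LM
open import Data.List.Relation.Unary.Unique.Propositional using (Unique)
open import Data.List.Relation.Unary.Linked using (Linked)
open import Data.Maybe using (Maybe; just; nothing; _>>=_)
import Data.Maybe.Properties as MP
open import Data.Product using (Σ; ∃; _×_; _,_)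
open import Data.Sum using (_⊎_)
open import Relation.Nullary using (¬_)
open import Relation.Binary.PropositionalEquality using (_≡_; _≢_)
open import Relation.Binary.Construct.Closure.ReflexiveTransitive using (Star)

_∈ₗ_ : ∀ {n} → Fin n → List (Fin n) → Set
x ∈ₗ p = x LM.∈ p

-- a directed path (in the digraph formed by the union of the paths):
-- a nonempty sequence of pairwise distinct vertices
IsPath : ∀ {n} → List (Fin n) → Set
IsPath p = (p ≢ []) × Unique p

Intersect : ∀ {n} → List (Fin n) → List (Fin n) → Set
Intersect p q = ∃ λ x → x ∈ₗ p × x ∈ₗ q

IsLinkage : ∀ {n k} → (Fin k → List (Fin n)) → Set
IsLinkage {k = k} L =
  (∀ i → IsPath (L i)) × (∀ i j → i ≢ j → ¬ Intersect (L i) (L j))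

IsWeb : ∀ {n h v} → (Fin h → List (Fin n)) → (Fin v → List (Fin n)) → Set
IsWeb ℋ 𝒱 = IsLinkage ℋ × IsLinkage 𝒱 × (∀ i j → Intersect (𝒱 j) (ℋ i))

-- splitting p = p¹ · p² at position k (< length p): p¹ ends and p² starts
-- at the common vertex, the (k+1)-st vertex of p
first : ∀ {n} → ℕ → List (Fin n) → List (Fin n)
first k p = take (suc k) p

second : ∀ {n} → ℕ → List (Fin n) → List (Fin n)
second k p = drop k p

IsTwoHorizontal : ∀ {n h v} → (Fin h → List (Fin n)) → (Fin v → List (Fin n)) → Set
IsTwoHorizontal ℋ 𝒱 =
  Σ (_ → ℕ) λ sH → Σ (_ → ℕ) λ sV →
    (∀ i → sH i < length (ℋ i)) × (∀ j → sV j < length (𝒱 j)) ×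
    (∀ i j →
      let H¹ = first (sH i) (ℋ i) ; H² = second (sH i) (ℋ i)
          V¹ = first (sV j) (𝒱 j) ; V² = second (sV j) (𝒱 j)
      in (∀ x → x ∈ₗ V¹ → x ∈ₗ ℋ i → (x ∈ₗ H¹) ⊎ (x ∈ₗ H²))
       × Intersect V¹ H²
       × (∀ x → x ∈ₗ V² → x ∈ₗ ℋ i → x ∈ₗ H¹)
       × Intersect V² H¹)

record Digraph (n : ℕ) : Set₁ where
  field
    Vtx : Fin n → Set
    Arc : Fin n → Fin n → Set
open Digraph public

Consecutive : ∀ {n} → Fin n → Fin n → List (Fin n) → Set
Consecutive x y p = ∃ λ as → ∃ λ bs → p ≡ as ++ x ∷ y ∷ bs

webDigraph : ∀ {n h v} → (Fin h → List (Fin n)) → (Fin v → List (Fin n)) → Digraph n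
webDigraph ℋ 𝒱 = record
  { Vtx = λ x → (∃ λ i → x ∈ₗ ℋ i) ⊎ (∃ λ j → x ∈ₗ 𝒱 j)
  ; Arc = λ x y → (∃ λ i → Consecutive x y (ℋ i)) ⊎ (∃ λ j → Consecutive x y (𝒱 j))
  }

SubsetOfV : ∀ {n} → Digraph n → Subset n → Set
SubsetOfV D Z = ∀ x → x ∈ Z → Vtx D x

ArcMinus : ∀ {n} → Digraph n → Subset n → Fin n → Fin n → Set
ArcMinus D Z x y = Arc D x y × x ∉ Z × y ∉ Z

Reach : ∀ {n} → Digraph n → Subset n → Fin n → Fin n → Set
Reach D Z = Star (ArcMinus D Z)

IsStrongComponent : ∀ {n} → Digraph n → Subset n → Subset n → Set
IsStrongComponent D Z S =
  (∃ λ x → x ∈ S)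
  × (∀ x → x ∈ S → Vtx D x × x ∉ Z)
  × (∀ x y → x ∈ S → y ∈ S → Reach D Z x y)
  × (∀ x y → x ∈ S → Vtx D y → y ∉ Z → Reach D Z x y → Reach D Z y x → y ∈ S)

HasHaven : ∀ {n} → Digraph n → ℕ → Set
HasHaven {n} D w =
  Σ (Subset n → Subset n) λ β →
    (∀ Z → SubsetOfV D Z → ∣ Z ∣ < w → IsStrongComponent D Z (β Z))
    × (∀ Z Z′ → SubsetOfV D Z → ∣ Z ∣ < w → Z′ ⊆ Z → β Z ⊆ β Z′)

ancestorOf : ∀ {m} → (Fin m → Maybe (Fin m)) → ℕ → Fin m → Maybe (Fin m)
ancestorOf par zero    u = just u
ancestorOf par (suc k) u = ancestorOf par k u >>= par

record Arborescence (m : ℕ) : Set where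
  field
    root   : Fin m
    parent : Fin m → Maybe (Fin m)
    root-parent : ∀ t → parent t ≡ nothing → t ≡ root
    parent-root : parent root ≡ nothing
  ancestor : ℕ → Fin m → Maybe (Fin m)
  ancestor = ancestorOf parent
  field
    reaches-root : ∀ t → ∃ λ k → ancestor k t ≡ just root
  -- u is reachable from t in T (u is a descendant of t, t itself included)
  Below : Fin m → Fin m → Set
  Below t u = ∃ λ k → ancestor k u ≡ just t
  children : Fin m → List (Fin m)
  children t = filter (λ c → MP.≡-dec _≟_ (parent c) (just t)) (allFin m)

IsClosedWalk : ∀ {n} → Digraph n → Subset n → List (Fin n) → Set
IsClosedWalk D Z []       = Data.Empty.⊥ where import Data.Empty
IsClosedWalk D Z (x ∷ rs) = Vtx D x × x ∉ Z × Linked (ArcMinus D Z) (x ∷ rs ++ [ x ])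

guardIf : ∀ {m n} → Maybe (Fin m) → Subset n → Subset n
guardIf nothing  g = ∅
guardIf (just _) g = g

-- a directed tree-decomposition (T, β, γ) of D; the guard of the arc
-- (parent t, t) is γ t (γ root is unused)
record DirTreeDecomposition {n} (D : Digraph n) : Set₁ where
  field
    m    : ℕ
    T    : Arborescence m
    bag  : Fin m → Subset n
    guard : Fin m → Subset n
  open Arborescence T
  InA : Fin m → Fin n → Set
  InA t x = ∃ λ u → Below t u × x ∈ bag u
  field
    bag-⊆      : ∀ t → SubsetOfV D (bag t)
    bag-cover  : ∀ x → Vtx D x → ∃ λ t → x ∈ bag t
    bag-disj   : ∀ x t t′ → x ∈ bag t → x ∈ bag t′ → t ≡ t′
    guard-⊆    : ∀ t → SubsetOfV D (guard t)
    guarded    : ∀ s t → parent t ≡ just s →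
                 ∀ W → IsClosedWalk D (guard t) W →
                 ¬ ((∃ λ a → a ∈ₗ W × InA t a) × (∃ λ b → b ∈ₗ W × Vtx D b × ¬ InA t b))
  inGuard : Fin m → Subset n
  inGuard t = guardIf (parent t) (guard t)
  nodeSet : Fin m → Subset n
  nodeSet t = bag t ∪ (inGuard t ∪ ⋃ (map guard (children t)))

HasWidthAtMost : ∀ {n} {D : Digraph n} → DirTreeDecomposition D → ℕ → Set
HasWidthAtMost d w = ∀ t → ∣ DirTreeDecomposition.nodeSet d t ∣ ≤ w + 1

DtwAtLeast : ∀ {n} → Digraph n → ℕ → Set₁
DtwAtLeast D k = ∀ (d : DirTreeDecomposition D) w → HasWidthAtMost d w → k ≤ w

{-# OPTIONS --safe #-}
module Submission where

-- Each Hᵢ has a junction vertex aᵢ, the common endpoint of Hᵢ¹ and Hᵢ², and each Vⱼ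
-- likewise a junction bⱼ.  If Hᵢ and Vⱼ both avoid Z, then aᵢ and bⱼ lie in the same
-- strong component of D − Z: walk along Hᵢ² to a vertex of Vⱼ¹ and along Vⱼ¹ to bⱼ,
-- then along Vⱼ² to a vertex of Hᵢ¹ and along Hᵢ¹ back to aᵢ.  When |Z| < min(h, v)
-- some Hᵢ and some Vⱼ avoid Z, since the paths of a linkage are disjoint, so the strong
-- component of D − Z containing aᵢ is well defined (Vⱼ links all such aᵢ), and it
-- shrinks as Z grows: a haven.
--
-- A haven β of order w rules out a directed tree-decomposition whose sets
-- Wₜ = bag(t) ∪ ⋃_{e ∋ t} γ(e) all have fewer than w vertices.  If β(Wₜ) lies in the
-- bags below t, it avoids bag(t) and so meets the bags below some child c; then the
-- strong component β(γ(c)) of D − γ(c) contains β(Wₜ) and β(W_c) and, by guardedness,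
-- cannot leave the bags below c.  Starting at the root, this descent never ends,
-- which is impossible in a finite tree.

open import Defs
open import Data.Nat using (ℕ; _⊓_; _∸_)
open import Data.Fin using (Fin)
open import Data.List using (List)
open import Data.Product using (_×_)

open import Data.Nat using (zero; suc; _<_; _≤_; _+_; _≤?_; z≤n; s≤s)
open import Data.Nat.Properties
  using (≤-refl; ≤-trans; ≤-pred; <-≤-trans; ≤-<-trans; ≰⇒>; +-comm; +-suc; m∸n+n≡m; m+1+n≰m; n≮n;
         m<n⊓o⇒m<n; m<n⊓o⇒m<o)
open import Data.Fin as Fin using (_≟_; toℕ; fromℕ<)
open import Data.Fin.Properties using (any?; suc-injective; toℕ-fromℕ<)
open import Data.Fin.Subset using (Subset; _∈_; _∉_; _⊆_; _⊂_; ∣_∣; _∪_; ⋃; ⁅_⁆; _-_) renaming (⊥ to ∅)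
open import Data.Fin.Subset.Properties
  using (_∈?_; _⊂?_; x∈p∪q⁻; p⊆p∪q; q⊆p∪q; x∈⁅x⁆; x∈⁅y⁆⇒x≡y; ∣⁅x⁆∣≡1; ∣p∣≤n; ∉⊥;
         p⊂q⇒∣p∣<∣q∣; p⊆q⇒∣p∣≤∣q∣; x∈p⇒∣p-x∣<∣p∣; x∈p∧x≢y⇒x∈p-y)
open import Data.List using ([]; _∷_; _++_; length; drop; map)
open import Data.List.Properties using (∷-injective)
open import Data.List.Membership.Propositional using (find; lose)
open import Data.List.Membership.Propositional.Properties using (∈-++⁺ʳ; ∈-filter⁺; ∈-allFin)
open import Data.List.Relation.Unary.Any using (here; there)
import Data.List.Relation.Unary.Any as Any
open import Data.List.Relation.Unary.Linked using (Linked; [-]; _∷_)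
open import Data.Vec using (tabulate)
open import Data.Vec.Properties using (lookup∘tabulate; []=⇒lookup; lookup⇒[]=)
open import Data.Maybe using (Maybe; just; nothing; _>>=_)
import Data.Maybe.Properties as Maybe
open import Data.Product using (∃; _,_; proj₁; proj₂)
open import Data.Sum using (_⊎_; inj₁; inj₂; [_,_]′)
open import Data.Empty using (⊥; ⊥-elim)
open import Function using (_∘_)
open import Relation.Nullary using (¬_; Dec; yes; no; does; contradiction)
open import Relation.Nullary.Decidable using (map′; dec-true; _×-dec_; _⊎-dec_; ¬?)
open import Relation.Binary.PropositionalEquality
  using (_≡_; _≢_; refl; sym; trans; cong; subst; module ≡-Reasoning)
open import Relation.Binary.Construct.Closure.ReflexiveTransitive using (Star; ε; _◅_; _◅◅_)
import Relation.Binary.Construct.Closure.ReflexiveTransitive as Star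

subsetOf : ∀ {n} {P : Fin n → Set} → (∀ x → Dec (P x)) → Subset n
subsetOf P? = tabulate (does ∘ P?)

∈-subsetOf⁺ : ∀ {n} {P : Fin n → Set} (P? : ∀ x → Dec (P x)) {x} → P x → x ∈ subsetOf P?
∈-subsetOf⁺ P? {x} px = lookup⇒[]= x _ (trans (lookup∘tabulate _ x) (dec-true (P? x) px))

∈-subsetOf⁻ : ∀ {n} {P : Fin n → Set} (P? : ∀ x → Dec (P x)) {x} → x ∈ subsetOf P? → P x
∈-subsetOf⁻ P? {x} x∈ with P? x | trans (sym (lookup∘tabulate (does ∘ P?) x)) ([]=⇒lookup x∈)
... | yes px | _ = px
... | no _   | ()

∈-⋃-map⁻ : ∀ {m n} (g : Fin m → Subset n) (cs : List (Fin m)) {x} → x ∈ ⋃ (map g cs) → ∃ λ c → x ∈ g c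
∈-⋃-map⁻ g []       x∈ = ⊥-elim (∉⊥ x∈)
∈-⋃-map⁻ g (c ∷ cs) x∈ with x∈p∪q⁻ (g c) _ x∈
... | inj₁ x∈gc = c , x∈gc
... | inj₂ x∈gs = ∈-⋃-map⁻ g cs x∈gs

∈-⋃-map⁺ : ∀ {m n} (g : Fin m → Subset n) {cs : List (Fin m)} {c} → c ∈ₗ cs → g c ⊆ ⋃ (map g cs)
∈-⋃-map⁺ g {c ∷ cs}  (here refl) x∈ = p⊆p∪q _ x∈
∈-⋃-map⁺ g {c′ ∷ cs} (there c∈)  x∈ = q⊆p∪q (g c′) _ (∈-⋃-map⁺ g c∈ x∈)

module StarDecidable {n} {R : Fin n → Fin n → Set} (R? : ∀ x y → Dec (R x y)) where

  Closed : Subset n → Set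
  Closed S = ∀ {x y} → x ∈ S → R x y → y ∈ S

  successor? : ∀ S y → Dec (∃ λ x → x ∈ S × R x y)
  successor? S y = any? λ x → x ∈? S ×-dec R? x y

  expand : Subset n → Subset n
  expand S = S ∪ subsetOf (successor? S)

  expand-⊇ : ∀ {S} → S ⊆ expand S
  expand-⊇ = p⊆p∪q _

  ∈-expand⁺ : ∀ {S x y} → x ∈ S → R x y → y ∈ expand S
  ∈-expand⁺ {S} x∈ r = q⊆p∪q S _ (∈-subsetOf⁺ (successor? S) (_ , x∈ , r))

  ∈-expand⁻ : ∀ {S y} → y ∈ expand S → y ∈ S ⊎ ∃ λ x → x ∈ S × R x y
  ∈-expand⁻ {S} y∈ with x∈p∪q⁻ S _ y∈
  ... | inj₁ y∈S    = inj₁ y∈S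
  ... | inj₂ y∈post = inj₂ (∈-subsetOf⁻ (successor? S) y∈post)

  expand-closed : ∀ {S} → Closed S → Closed (expand S)
  expand-closed cl x∈ r with ∈-expand⁻ x∈
  ... | inj₁ x∈S            = expand-⊇ (cl x∈S r)
  ... | inj₂ (z , z∈S , r′) = expand-⊇ (cl (cl z∈S r′) r)

  closed-or-⊂-expand : ∀ S → Closed S ⊎ S ⊂ expand S
  closed-or-⊂-expand S with S ⊂? expand S
  ... | yes S⊂ = inj₂ S⊂
  ... | no S⊄  = inj₁ closed
    where
    closed : Closed S
    closed {x} {y} x∈ r with y ∈? S
    ... | yes y∈ = y∈
    ... | no y∉  = ⊥-elim (S⊄ (expand-⊇ , y , ∈-expand⁺ x∈ r , y∉))

  reachableWithin : ℕ → Fin n → Subset n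
  reachableWithin zero    a = ⁅ a ⁆
  reachableWithin (suc k) a = expand (reachableWithin k a)

  start-reachableWithin : ∀ k a → a ∈ reachableWithin k a
  start-reachableWithin zero    a = x∈⁅x⁆ a
  start-reachableWithin (suc k) a = expand-⊇ (start-reachableWithin k a)

  reachableWithin-sound : ∀ k a {x} → x ∈ reachableWithin k a → Star R a x
  reachableWithin-sound zero a x∈ with x∈⁅y⁆⇒x≡y a x∈
  ... | refl = ε
  reachableWithin-sound (suc k) a x∈ with ∈-expand⁻ x∈
  ... | inj₁ x∈′          = reachableWithin-sound k a x∈′
  ... | inj₂ (z , z∈ , r) = reachableWithin-sound k a z∈ ◅◅ (r ◅ ε)

  reachableWithin-closed-or-large : ∀ k a → Closed (reachableWithin k a) ⊎ k < ∣ reachableWithin k a ∣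
  reachableWithin-closed-or-large zero    a = inj₂ (subst (0 <_) (sym (∣⁅x⁆∣≡1 a)) (s≤s z≤n))
  reachableWithin-closed-or-large (suc k) a with reachableWithin-closed-or-large k a
  ... | inj₁ closed = inj₁ (expand-closed closed)
  ... | inj₂ large with closed-or-⊂-expand (reachableWithin k a)
  ...   | inj₁ closed = inj₁ (expand-closed closed)
  ...   | inj₂ grows  = inj₂ (≤-<-trans large (p⊂q⇒∣p∣<∣q∣ grows))

  -- Until it is closed, the set grows by a vertex in every round.
  reachableWithin-closed : ∀ a → Closed (reachableWithin n a)
  reachableWithin-closed a with reachableWithin-closed-or-large n a
  ... | inj₁ closed = closed
  ... | inj₂ large  = contradiction (<-≤-trans large (∣p∣≤n (reachableWithin n a))) (n≮n n)

  closed-complete : ∀ {S a x} → Closed S → a ∈ S → Star R a x → x ∈ S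
  closed-complete closed a∈ ε       = a∈
  closed-complete closed a∈ (r ◅ s) = closed-complete closed (closed a∈ r) s

  star? : ∀ a x → Dec (Star R a x)
  star? a x = map′ (reachableWithin-sound n a)
                   (closed-complete (reachableWithin-closed a) (start-reachableWithin n a))
                   (x ∈? reachableWithin n a)

Reach-antimono : ∀ {n} {D : Digraph n} {Z Z′ : Subset n} {x y} → Z′ ⊆ Z → Reach D Z x y → Reach D Z′ x y
Reach-antimono Z′⊆Z = Star.map λ (arc , x∉ , y∉) → arc , x∉ ∘ Z′⊆Z , y∉ ∘ Z′⊆Z

module _ {n} {R : Fin n → Fin n → Set} where

  initials : ∀ {x y} → Star R x y → List (Fin n)
  initials ε           = []
  initials {x} (_ ◅ s) = x ∷ initials s

  initials-linked : ∀ {x z y ys} → R x z → (s : Star R z y) → Linked R (y ∷ ys) →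
                    Linked R (x ∷ initials s ++ y ∷ ys)
  initials-linked r ε        l = r ∷ l
  initials-linked r (r′ ◅ s) l = r ∷ initials-linked r′ s l

  ∈-initials-◅◅ : ∀ {x y z u} (s : Star R x y) (r : R y z) (s′ : Star R z u) →
                  y ∈ₗ initials (s ◅◅ r ◅ s′)
  ∈-initials-◅◅ ε       r s′ = here refl
  ∈-initials-◅◅ (_ ◅ s) r s′ = there (∈-initials-◅◅ s r s′)

closedWalk-through : ∀ {n} {D : Digraph n} {Z : Subset n} {x y} → x ≢ y →
                     Reach D Z x y → Reach D Z y x → Vtx D x × x ∉ Z →
                     ∃ λ W → IsClosedWalk D Z W × x ∈ₗ W × y ∈ₗ W
closedWalk-through x≢y ε       _         _          = ⊥-elim (x≢y refl)
closedWalk-through x≢y (_ ◅ _) ε         _          = ⊥-elim (x≢y refl)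
closedWalk-through {x = x} x≢y (r ◅ s) (r′ ◅ s′) (x∈D , x∉Z) =
  x ∷ initials (s ◅◅ r′ ◅ s′) ,
  (x∈D , x∉Z , initials-linked r (s ◅◅ r′ ◅ s′) [-]) ,
  here refl ,
  there (∈-initials-◅◅ s r′ s′)

module Components {n} (D : Digraph n) (arc? : ∀ x y → Dec (Arc D x y))
                  (arc-head : ∀ {x y} → Arc D x y → Vtx D y) where

  reach? : ∀ Z a x → Dec (Reach D Z a x)
  reach? Z = StarDecidable.star? λ x y → arc? x y ×-dec (¬? (x ∈? Z) ×-dec ¬? (y ∈? Z))

  mutuallyReachable? : ∀ Z a x → Dec (Reach D Z a x × Reach D Z x a)
  mutuallyReachable? Z a x = reach? Z a x ×-dec reach? Z x a

  component : Subset n → Fin n → Subset n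
  component Z a = subsetOf (mutuallyReachable? Z a)

  reach-stays : ∀ {Z a x} → Reach D Z a x → Vtx D a × a ∉ Z → Vtx D x × x ∉ Z
  reach-stays ε                     a∈D−Z = a∈D−Z
  reach-stays ((arc , _ , y∉Z) ◅ s) _     = reach-stays s (arc-head arc , y∉Z)

  component-strong : ∀ {Z a} → Vtx D a × a ∉ Z → IsStrongComponent D Z (component Z a)
  component-strong {Z} {a} a∈D−Z =
    (a , ∈⁺ (ε , ε)) ,
    (λ x x∈ → reach-stays (proj₁ (∈⁻ x∈)) a∈D−Z) ,
    (λ x y x∈ y∈ → proj₂ (∈⁻ x∈) ◅◅ proj₁ (∈⁻ y∈)) ,
    (λ x y x∈ _ _ x→y y→x → ∈⁺ (proj₁ (∈⁻ x∈) ◅◅ x→y , y→x ◅◅ proj₂ (∈⁻ x∈)))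
    where
    ∈⁺ : ∀ {x} → Reach D Z a x × Reach D Z x a → x ∈ component Z a
    ∈⁺ = ∈-subsetOf⁺ (mutuallyReachable? Z a)
    ∈⁻ : ∀ {x} → x ∈ component Z a → Reach D Z a x × Reach D Z x a
    ∈⁻ = ∈-subsetOf⁻ (mutuallyReachable? Z a)

  component-⊆ : ∀ {Z Z′ a a′} → Z′ ⊆ Z → Reach D Z′ a′ a → Reach D Z′ a a′ →
                component Z a ⊆ component Z′ a′
  component-⊆ {Z} {Z′} {a} {a′} Z′⊆Z a′→a a→a′ x∈ =
    let (a→x , x→a) = ∈-subsetOf⁻ (mutuallyReachable? Z a) x∈ in
    ∈-subsetOf⁺ (mutuallyReachable? Z′ a′)
      (a′→a ◅◅ Reach-antimono {D = D} Z′⊆Z a→x , Reach-antimono {D = D} Z′⊆Z x→a ◅◅ a→a′)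

ancestorOf-+ : ∀ {m} (par : Fin m → Maybe (Fin m)) k j u →
               ancestorOf par (k + j) u ≡ (ancestorOf par j u >>= ancestorOf par k)
ancestorOf-+ par zero j u with ancestorOf par j u
... | nothing = refl
... | just _  = refl
ancestorOf-+ par (suc k) j u rewrite ancestorOf-+ par k j u with ancestorOf par j u
... | nothing = refl
... | just _  = refl

module ArborescenceProperties {m} (T : Arborescence m) where
  open Arborescence T

  ancestor-root : ∀ j → ancestor (suc j) root ≡ nothing
  ancestor-root zero                            = parent-root
  ancestor-root (suc j) rewrite ancestor-root j = refl

  ancestor-beyond-root : ∀ {u k₀} → ancestor k₀ u ≡ just root → ∀ j → ancestor (suc j + k₀) u ≡ nothing
  ancestor-beyond-root {u} {k₀} at-root j
    rewrite ancestorOf-+ parent (suc j) k₀ u | at-root = ancestor-root j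

  depth-bound : ∀ {u t k₀ k} → ancestor k₀ u ≡ just root → ancestor k u ≡ just t → k ≤ k₀
  depth-bound {u} {t} {k₀} {k} at-root at-t with k ≤? k₀
  ... | yes k≤k₀ = k≤k₀
  ... | no k≰k₀ = contradiction just-t≡nothing λ ()
    where
    open ≡-Reasoning
    j = k ∸ suc k₀
    k≡ : k ≡ suc j + k₀
    k≡ = trans (sym (m∸n+n≡m (≰⇒> k≰k₀))) (+-suc j k₀)
    just-t≡nothing : just t ≡ nothing
    just-t≡nothing = begin
      just t                  ≡⟨ sym at-t ⟩
      ancestor k u            ≡⟨ cong (λ k → ancestor k u) k≡ ⟩
      ancestor (suc j + k₀) u ≡⟨ ancestor-beyond-root at-root j ⟩
      nothing                 ∎

  Below? : ∀ t u → Dec (Below t u)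
  Below? t u with reaches-root u
  ... | (k₀ , at-root) =
    map′ (λ (k , at-t) → toℕ k , at-t)
         (λ (k , at-t) → let k<1+k₀ = s≤s (depth-bound {k = k} at-root at-t) in
                         fromℕ< k<1+k₀ ,
                         subst (λ i → ancestor i u ≡ just t) (sym (toℕ-fromℕ< k<1+k₀)) at-t)
         (any? λ (k : Fin (suc k₀)) → Maybe.≡-dec _≟_ (ancestor (toℕ k) u) (just t))

  Below-parent : ∀ {t c u} → parent c ≡ just t → Below c u → Below t u
  Below-parent c→t (k , at-c) = suc k , trans (cong (_>>= parent) at-c) c→t

  child-not-above-parent : ∀ {t c} → parent c ≡ just t → ¬ Below c t
  child-not-above-parent {t} c→t (k , at-c) with reaches-root t
  ... | (k₀ , at-root) = m+1+n≰m k₀ (depth-bound {k = k₀ + suc k} at-root root-again)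
    where
    open ≡-Reasoning
    t-above-t : ancestor (suc k) t ≡ just t
    t-above-t = proj₂ (Below-parent c→t (k , at-c))
    root-again : ancestor (k₀ + suc k) t ≡ just root
    root-again = begin
      ancestor (k₀ + suc k) t              ≡⟨ ancestorOf-+ parent k₀ (suc k) t ⟩
      (ancestor (suc k) t >>= ancestor k₀) ≡⟨ cong (_>>= ancestor k₀) t-above-t ⟩
      ancestor k₀ t                        ≡⟨ at-root ⟩
      just root                            ∎

  descendants : Fin m → Subset m
  descendants t = subsetOf (Below? t)

  descendants-child-⊂ : ∀ {t c} → parent c ≡ just t → descendants c ⊂ descendants t
  descendants-child-⊂ {t} {c} c→t =
    (λ u∈ → ∈-subsetOf⁺ (Below? t) (Below-parent c→t (∈-subsetOf⁻ (Below? c) u∈))) ,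
    t , ∈-subsetOf⁺ (Below? t) (0 , refl) , child-not-above-parent c→t ∘ ∈-subsetOf⁻ (Below? c)

  no-infinite-descent : ∀ {P : Fin m → Set} → (∀ t → P t → ∃ λ c → parent c ≡ just t × P c) → ∀ t → ¬ P t
  no-infinite-descent {P} step t = descend (suc ∣ descendants t ∣) t ≤-refl
    where
    descend : ∀ N t → ∣ descendants t ∣ < N → ¬ P t
    descend zero    t ()
    descend (suc N) t size<N Pt with step t Pt
    ... | (c , c→t , Pc) =
      descend N c (<-≤-trans (p⊂q⇒∣p∣<∣q∣ (descendants-child-⊂ c→t)) (≤-pred size<N)) Pc

guardIf-⊆ : ∀ {m n} (mp : Maybe (Fin m)) {g : Subset n} → guardIf mp g ⊆ g
guardIf-⊆ nothing  x∈ = ⊥-elim (∉⊥ x∈)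
guardIf-⊆ (just _) x∈ = x∈

module HavenObstruction {n} {D : Digraph n} {w} {β : Subset n → Subset n}
  (β-strong : ∀ Z → SubsetOfV D Z → ∣ Z ∣ < w → IsStrongComponent D Z (β Z))
  (β-mono : ∀ Z Z′ → SubsetOfV D Z → ∣ Z ∣ < w → Z′ ⊆ Z → β Z ⊆ β Z′)
  (d : DirTreeDecomposition D)
  (narrow : ∀ t → ∣ DirTreeDecomposition.nodeSet d t ∣ < w) where
  open DirTreeDecomposition d
  open Arborescence T
  open ArborescenceProperties T

  nodeSet-⊆V : ∀ t → SubsetOfV D (nodeSet t)
  nodeSet-⊆V t x x∈ with x∈p∪q⁻ (bag t) _ x∈
  ... | inj₁ x∈bag = bag-⊆ t x x∈bag
  ... | inj₂ x∈guards with x∈p∪q⁻ (inGuard t) _ x∈guards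
  ...   | inj₁ x∈in  = guard-⊆ t x (guardIf-⊆ (parent t) x∈in)
  ...   | inj₂ x∈out = let (c , x∈c) = ∈-⋃-map⁻ guard (children t) x∈out in guard-⊆ c x x∈c

  guard-⊆-nodeSet-parent : ∀ {t c} → parent c ≡ just t → guard c ⊆ nodeSet t
  guard-⊆-nodeSet-parent {t} {c} c→t x∈ =
    q⊆p∪q (bag t) _ (q⊆p∪q (inGuard t) _
      (∈-⋃-map⁺ guard (∈-filter⁺ (λ c → Maybe.≡-dec _≟_ (parent c) (just t)) (∈-allFin c) c→t) x∈))

  guard-⊆-nodeSet : ∀ {t c} → parent c ≡ just t → guard c ⊆ nodeSet c
  guard-⊆-nodeSet {t} {c} c→t {x} x∈ =
    q⊆p∪q (bag c) _ (p⊆p∪q _ (subst (λ mp → x ∈ guardIf mp (guard c)) (sym c→t) x∈))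

  outside-A : ∀ {c u y} → y ∈ bag u → ¬ Below c u → ¬ InA c y
  outside-A {c} {u} {y} y∈u c≰u (u′ , c≤u′ , y∈u′) =
    c≰u (subst (Below c) (bag-disj y u′ u y∈u′ y∈u) c≤u′)

  strongComponent-below : ∀ {t c S x} → parent c ≡ just t → IsStrongComponent D (guard c) S →
                          x ∈ S → InA c x → ∀ y → y ∈ S → InA c y
  strongComponent-below {t} {c} {S} {x} c→t (_ , in-D−γ , connected , _) x∈S x∈A y y∈S
    with bag-cover y (proj₁ (in-D−γ y y∈S))
  ... | (u , y∈u) with Below? c u
  ...   | yes c≤u = u , c≤u , y∈u
  ...   | no c≰u with x ≟ y
  ...     | yes refl = contradiction x∈A (outside-A y∈u c≰u)
  ...     | no x≢y
    with closedWalk-through x≢y (connected x y x∈S y∈S) (connected y x y∈S x∈S) (in-D−γ x x∈S)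
  ...       | (W , closed , x∈W , y∈W) =
                ⊥-elim (guarded t c c→t W closed
                          ((x , x∈W , x∈A) , (y , y∈W , proj₁ (in-D−γ y y∈S) , outside-A y∈u c≰u)))

  β-guard-strong : ∀ {t c} → parent c ≡ just t → IsStrongComponent D (guard c) (β (guard c))
  β-guard-strong {t} {c} c→t =
    β-strong (guard c) (guard-⊆ c) (≤-<-trans (p⊆q⇒∣p∣≤∣q∣ (guard-⊆-nodeSet-parent c→t)) (narrow t))

  β-parent-⊆-β-guard : ∀ {t c} → parent c ≡ just t → β (nodeSet t) ⊆ β (guard c)
  β-parent-⊆-β-guard {t} c→t = β-mono _ _ (nodeSet-⊆V t) (narrow t) (guard-⊆-nodeSet-parent c→t)

  β-child-⊆-β-guard : ∀ {t c} → parent c ≡ just t → β (nodeSet c) ⊆ β (guard c)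
  β-child-⊆-β-guard {c = c} c→t = β-mono _ _ (nodeSet-⊆V c) (narrow c) (guard-⊆-nodeSet c→t)

  ComponentBelow : Fin m → Set
  ComponentBelow t = ∀ x → x ∈ β (nodeSet t) → InA t x

  componentBelow-root : ComponentBelow root
  componentBelow-root x x∈ with β-strong _ (nodeSet-⊆V root) (narrow root)
  ... | (_ , in-D−W , _) with bag-cover x (proj₁ (in-D−W x x∈))
  ...   | (u , x∈u) = u , reaches-root u , x∈u

  componentBelow-child : ∀ t → ComponentBelow t → ∃ λ c → parent c ≡ just t × ComponentBelow c
  componentBelow-child t below-t with β-strong _ (nodeSet-⊆V t) (narrow t)
  ... | ((x , x∈β) , in-D−W , _) with below-t x x∈β
  ...   | (u , (zero , u≡t) , x∈u) =
            contradiction (p⊆p∪q _ (subst (λ u → x ∈ bag u) (Maybe.just-injective u≡t) x∈u))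
                          (proj₂ (in-D−W x x∈β))
  ...   | (u , (suc k , at-t) , x∈u) with ancestor k u in at-c
  ...     | just c = c , at-t , below-c
    where
    below-c : ComponentBelow c
    below-c y y∈ = strongComponent-below at-t (β-guard-strong at-t)
                     (β-parent-⊆-β-guard at-t x∈β) (u , (k , at-c) , x∈u) y (β-child-⊆-β-guard at-t y∈)

  impossible : ⊥
  impossible = no-infinite-descent componentBelow-child root componentBelow-root

haven⇒dtw≥ : ∀ {n} (D : Digraph n) w → HasHaven D w → DtwAtLeast D (w ∸ 1)
haven⇒dtw≥ D zero    _                         _ _ _     = z≤n
haven⇒dtw≥ D (suc w) (β , β-strong , β-mono) d k width with w ≤? k
... | yes w≤k = w≤k
... | no w≰k  = ⊥-elim (HavenObstruction.impossible β-strong β-mono d narrow)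
  where
  narrow : ∀ t → ∣ DirTreeDecomposition.nodeSet d t ∣ < suc w
  narrow t = s≤s (≤-trans (width t) (subst (_≤ w) (+-comm 1 k) (≰⇒> w≰k)))

Avoids : ∀ {n} → Subset n → List (Fin n) → Set
Avoids Z p = ∀ x → x ∈ₗ p → x ∉ Z

avoids-or-meets : ∀ {n} (Z : Subset n) p → Avoids Z p ⊎ ∃ λ x → x ∈ₗ p × x ∈ Z
avoids-or-meets Z p with Any.any? (_∈? Z) p
... | yes hit = inj₂ (find hit)
... | no miss = inj₁ λ x x∈p x∈Z → miss (lose x∈p x∈Z)

avoids? : ∀ {n} (Z : Subset n) p → Dec (Avoids Z p)
avoids? Z p = [ yes , (λ (x , x∈p , x∈Z) → no λ avoids → avoids x x∈p x∈Z) ]′ (avoids-or-meets Z p)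

Avoids-antimono : ∀ {n} {Z Z′ : Subset n} {p} → Z′ ⊆ Z → Avoids Z p → Avoids Z′ p
Avoids-antimono Z′⊆Z avoids x x∈p = avoids x x∈p ∘ Z′⊆Z

PairwiseDisjoint : ∀ {n k} → (Fin k → List (Fin n)) → Set
PairwiseDisjoint L = ∀ i j → i ≢ j → ¬ Intersect (L i) (L j)

-- Each path meeting Z uses up a vertex of Z that no other path contains.
some-path-avoids : ∀ {n k} {L : Fin k → List (Fin n)} → PairwiseDisjoint L →
                   ∀ Z → ∣ Z ∣ < k → ∃ λ i → Avoids Z (L i)
some-path-avoids {k = suc k} {L} disjoint Z ∣Z∣≤k with avoids-or-meets Z (L Fin.zero)
... | inj₁ avoids₀ = Fin.zero , avoids₀
... | inj₂ (x , x∈L₀ , x∈Z)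
  with some-path-avoids (λ i j i≢j → disjoint (Fin.suc i) (Fin.suc j) (i≢j ∘ suc-injective)) (Z - x)
                        (<-≤-trans (x∈p⇒∣p-x∣<∣p∣ x∈Z) (≤-pred ∣Z∣≤k))
... | (i , avoids) = Fin.suc i , λ y y∈Lᵢ y∈Z →
  avoids y y∈Lᵢ (x∈p∧x≢y⇒x∈p-y y∈Z λ { refl → disjoint Fin.zero (Fin.suc i) (λ ()) (y , x∈L₀ , y∈Lᵢ) })

Along : ∀ {n} → List (Fin n) → Fin n → Fin n → Set
Along p = Star λ x y → Consecutive x y p

consecutive-∈ : ∀ {n} {x y : Fin n} {p} → Consecutive x y p → x ∈ₗ p × y ∈ₗ p
consecutive-∈ (as , _ , refl) = ∈-++⁺ʳ as (here refl) , ∈-++⁺ʳ as (there (here refl))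

consecutive? : ∀ {n} (x y : Fin n) p → Dec (Consecutive x y p)
consecutive? x y []            = no λ { ([] , _ , ()) ; (_ ∷ _ , _ , ()) }
consecutive? x y (z ∷ [])      = no λ { ([] , _ , ()) ; (_ ∷ [] , _ , ()) ; (_ ∷ _ ∷ _ , _ , ()) }
consecutive? x y (z ∷ z′ ∷ p) =
  map′ [ atHead , inTail ]′ split ((z ≟ x ×-dec z′ ≟ y) ⊎-dec consecutive? x y (z′ ∷ p))
  where
  atHead : z ≡ x × z′ ≡ y → Consecutive x y (z ∷ z′ ∷ p)
  atHead (refl , refl) = [] , p , refl
  inTail : Consecutive x y (z′ ∷ p) → Consecutive x y (z ∷ z′ ∷ p)
  inTail (as , bs , eq) = z ∷ as , bs , cong (z ∷_) eq
  split : Consecutive x y (z ∷ z′ ∷ p) → (z ≡ x × z′ ≡ y) ⊎ Consecutive x y (z′ ∷ p)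
  split ([] , _ , refl)       = inj₁ (refl , refl)
  split (_ ∷ as , bs , eq) = inj₂ (as , bs , proj₂ (∷-injective eq))

along-∷ : ∀ {n} {z : Fin n} {p x y} → Along p x y → Along (z ∷ p) x y
along-∷ {z = z} = Star.map λ (as , bs , eq) → z ∷ as , bs , cong (z ∷_) eq

head-reaches : ∀ {n} {z y : Fin n} {p} → y ∈ₗ (z ∷ p) → Along (z ∷ p) z y
head-reaches (here refl)                     = ε
head-reaches {p = z′ ∷ p} (there y∈) = ([] , p , refl) ◅ along-∷ (head-reaches y∈)

∈-drop⁻ : ∀ {n} {x : Fin n} s p → x ∈ₗ drop s p → x ∈ₗ p
∈-drop⁻ zero    p       x∈ = x∈
∈-drop⁻ (suc s) (y ∷ p) x∈ = there (∈-drop⁻ s p x∈)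

first-reaches-second : ∀ {n} (p : List (Fin n)) s {x y} → x ∈ₗ first s p → y ∈ₗ second s p → Along p x y
first-reaches-second (z ∷ p) zero    (here refl) y∈ = head-reaches y∈
first-reaches-second (z ∷ p) (suc s) (here refl) y∈ = head-reaches (there (∈-drop⁻ s p y∈))
first-reaches-second (z ∷ p) (suc s) (there x∈)  y∈ = along-∷ (first-reaches-second p s x∈ y∈)

junction : ∀ {n} (p : List (Fin n)) s → s < length p → ∃ λ x → x ∈ₗ first s p × x ∈ₗ second s p
junction (x ∷ p) zero    _         = x , here refl , here refl
junction (x ∷ p) (suc s) (s≤s s<) =
  let (y , y∈first , y∈second) = junction p s s< in y , there y∈first , y∈second

along⇒reach : ∀ {n} {D : Digraph n} {Z p} → (∀ {x y} → Consecutive x y p → Arc D x y) → Avoids Z p →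
              ∀ {x y} → Along p x y → Reach D Z x y
along⇒reach arc avoids =
  Star.map λ c → arc c , avoids _ (proj₁ (consecutive-∈ c)) , avoids _ (proj₂ (consecutive-∈ c))

module _ {n h v} (ℋ : Fin h → List (Fin n)) (𝒱 : Fin v → List (Fin n)) where

  webDigraph-arc? : ∀ x y → Dec (Arc (webDigraph ℋ 𝒱) x y)
  webDigraph-arc? x y = any? (λ i → consecutive? x y (ℋ i)) ⊎-dec any? (λ j → consecutive? x y (𝒱 j))

  webDigraph-arc-head : ∀ {x y} → Arc (webDigraph ℋ 𝒱) x y → Vtx (webDigraph ℋ 𝒱) y
  webDigraph-arc-head (inj₁ (i , c)) = inj₁ (i , proj₂ (consecutive-∈ c))
  webDigraph-arc-head (inj₂ (j , c)) = inj₂ (j , proj₂ (consecutive-∈ c))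

module WebHaven {n h v} (ℋ : Fin h → List (Fin n)) (𝒱 : Fin v → List (Fin n))
  (ℋ-disjoint : PairwiseDisjoint ℋ) (𝒱-disjoint : PairwiseDisjoint 𝒱)
  (sH : Fin h → ℕ) (sV : Fin v → ℕ)
  (sH< : ∀ i → sH i < length (ℋ i)) (sV< : ∀ j → sV j < length (𝒱 j))
  (crossing : ∀ i j → Intersect (first (sV j) (𝒱 j)) (second (sH i) (ℋ i))
                    × Intersect (second (sV j) (𝒱 j)) (first (sH i) (ℋ i))) where

  D : Digraph n
  D = webDigraph ℋ 𝒱

  open Components D (webDigraph-arc? ℋ 𝒱) (webDigraph-arc-head ℋ 𝒱)

  a : Fin h → Fin n
  a i = proj₁ (junction (ℋ i) (sH i) (sH< i))

  b : Fin v → Fin n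
  b j = proj₁ (junction (𝒱 j) (sV j) (sV< j))

  a∈ℋ : ∀ i → a i ∈ₗ ℋ i
  a∈ℋ i = ∈-drop⁻ (sH i) (ℋ i) (proj₂ (proj₂ (junction (ℋ i) (sH i) (sH< i))))

  junctions-connected : ∀ {Z i j} → Avoids Z (ℋ i) → Avoids Z (𝒱 j) →
                        Reach D Z (a i) (b j) × Reach D Z (b j) (a i)
  junctions-connected {Z} {i} {j} ℋᵢ-avoids 𝒱ⱼ-avoids with crossing i j
  ... | (x , x∈𝒱¹ , x∈ℋ²) , (y , y∈𝒱² , y∈ℋ¹) =
        alongℋ (first-reaches-second (ℋ i) (sH i) a∈ℋ¹ x∈ℋ²) ◅◅
        along𝒱 (first-reaches-second (𝒱 j) (sV j) x∈𝒱¹ b∈𝒱²) ,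
        along𝒱 (first-reaches-second (𝒱 j) (sV j) b∈𝒱¹ y∈𝒱²) ◅◅
        alongℋ (first-reaches-second (ℋ i) (sH i) y∈ℋ¹ a∈ℋ²)
    where
    a∈ℋ¹ = proj₁ (proj₂ (junction (ℋ i) (sH i) (sH< i)))
    a∈ℋ² = proj₂ (proj₂ (junction (ℋ i) (sH i) (sH< i)))
    b∈𝒱¹ = proj₁ (proj₂ (junction (𝒱 j) (sV j) (sV< j)))
    b∈𝒱² = proj₂ (proj₂ (junction (𝒱 j) (sV j) (sV< j)))
    alongℋ : ∀ {x y} → Along (ℋ i) x y → Reach D Z x y
    alongℋ = along⇒reach {D = D} (λ c → inj₁ (i , c)) ℋᵢ-avoids
    along𝒱 : ∀ {x y} → Along (𝒱 j) x y → Reach D Z x y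
    along𝒱 = along⇒reach {D = D} (λ c → inj₂ (j , c)) 𝒱ⱼ-avoids

  ℋ-junctions-connected : ∀ {Z i i′ j} → Avoids Z (ℋ i) → Avoids Z (ℋ i′) → Avoids Z (𝒱 j) →
                          Reach D Z (a i) (a i′)
  ℋ-junctions-connected ℋᵢ-avoids ℋᵢ′-avoids 𝒱ⱼ-avoids =
    proj₁ (junctions-connected ℋᵢ-avoids 𝒱ⱼ-avoids) ◅◅ proj₂ (junctions-connected ℋᵢ′-avoids 𝒱ⱼ-avoids)

  -- β Z = ∅ when every path of ℋ meets Z; that only happens for ∣ Z ∣ ≥ h.
  β : Subset n → Subset n
  β Z with any? (λ i → avoids? Z (ℋ i))
  ... | yes (i , _) = component Z (a i)
  ... | no _        = ∅

  β-chosen : ∀ Z → ∣ Z ∣ < h → ∃ λ i → Avoids Z (ℋ i) × β Z ≡ component Z (a i)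
  β-chosen Z ∣Z∣<h with any? (λ i → avoids? Z (ℋ i))
  ... | yes (i , avoids) = i , avoids , refl
  ... | no none          = contradiction (some-path-avoids ℋ-disjoint Z ∣Z∣<h) none

  β-strong : ∀ Z → SubsetOfV D Z → ∣ Z ∣ < h ⊓ v → IsStrongComponent D Z (β Z)
  β-strong Z _ ∣Z∣< with β-chosen Z (m<n⊓o⇒m<n h v ∣Z∣<)
  ... | (i , avoids , β≡) =
    subst (IsStrongComponent D Z) (sym β≡) (component-strong (inj₁ (i , a∈ℋ i) , avoids _ (a∈ℋ i)))

  β-mono : ∀ Z Z′ → SubsetOfV D Z → ∣ Z ∣ < h ⊓ v → Z′ ⊆ Z → β Z ⊆ β Z′
  β-mono Z Z′ _ ∣Z∣< Z′⊆Z
    with β-chosen Z (m<n⊓o⇒m<n h v ∣Z∣<) | β-chosen Z′ (m<n⊓o⇒m<n h v ∣Z′∣<)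
       | some-path-avoids 𝒱-disjoint Z′ (m<n⊓o⇒m<o h v ∣Z′∣<)
    where
    ∣Z′∣< : ∣ Z′ ∣ < h ⊓ v
    ∣Z′∣< = ≤-<-trans (p⊆q⇒∣p∣≤∣q∣ Z′⊆Z) ∣Z∣<
  ... | (i , avoids , β≡) | (i′ , avoids′ , β′≡) | (j , 𝒱ⱼ-avoids) rewrite β≡ | β′≡ =
    component-⊆ Z′⊆Z (ℋ-junctions-connected avoids′ (Avoids-antimono Z′⊆Z avoids) 𝒱ⱼ-avoids)
                     (ℋ-junctions-connected (Avoids-antimono Z′⊆Z avoids) avoids′ 𝒱ⱼ-avoids)

  haven : HasHaven D (h ⊓ v)
  haven = β , β-strong , β-mono

mainTheorem15 : ∀ (n h v : ℕ) (ℋ : Fin h → List (Fin n)) (𝒱 : Fin v → List (Fin n)) →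
    IsWeb ℋ 𝒱 → IsTwoHorizontal ℋ 𝒱 →
    HasHaven (webDigraph ℋ 𝒱) (h ⊓ v) × DtwAtLeast (webDigraph ℋ 𝒱) ((h ⊓ v) ∸ 1)
mainTheorem15 n h v ℋ 𝒱 ((_ , ℋ-disjoint) , (_ , 𝒱-disjoint) , _) (sH , sV , sH< , sV< , split) =
  haven , haven⇒dtw≥ (webDigraph ℋ 𝒱) (h ⊓ v) haven
  where
  crossing : ∀ i j → Intersect (first (sV j) (𝒱 j)) (second (sH i) (ℋ i))
                   × Intersect (second (sV j) (𝒱 j)) (first (sH i) (ℋ i))
  crossing i j = let (_ , V¹∩H² , _ , V²∩H¹) = split i j in V¹∩H² , V²∩H¹
  haven : HasHaven (webDigraph ℋ 𝒱) (h ⊓ v)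
  haven = WebHaven.haven ℋ 𝒱 ℋ-disjoint 𝒱-disjoint sH sV sH< sV< crossing
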